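{- Let $H=\{\cdot\mid 1\}$ and let $\mathcal{U}=\mathcal{D}(H)$. Then $H\equiv_{\mathcal{U}}0$.
   Context: Games are finite partizan games $\{\mathscr{G}^L\mid\mathscr{G}^R\}$, $\cdot$ denoting no options; $0=\{\cdot\mid\cdot\}$, $1=\{0\mid\cdot\}$. Sum $G+H=\{G^L+H,G+H^L\mid G^R+H,G+H^R\}$; conjugate $\overline{G}=\{\overline{G^R}\mid\overline{G^L}\}$. Misère outcomes: $o^L(G)=\mathscr{L}$ iff $G$ has no Left option or some $o^R(G^L)=\mathscr{L}$ (else $\mathscr{R}$); $o^R(G)=\mathscr{R}$ iff $G$ has no Right option or some $o^L(G^R)=\mathscr{R}$ (else $\mathscr{L}$); $o(G)$ is the pair $(o^L(G),o^R(G))$. A universe is a set of games closed under options, sums, conjugates, and forming $\{\mathscr{S}\mid\mathscr{T}\}$ for nonempty finite subsets $\mathscr{S},\mathscr{T}$; $\mathcal{D}(\mathcal{A})$ is the smallest universe containing $\mathcal{A}$. $G\equiv_{\mathcal{U}}H$ means $o(G+X)=o(H+X)$ for all $X\in\mathcal{U}$. -}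

module Defs where

open import Data.Nat using (ℕ; zero; suc; _+_)
open import Data.Fin using (Fin; splitAt)
open import Data.Sum using (_⊎_; inj₁; inj₂; [_,_])
open import Data.Product using (_×_; _,_; Σ)
open import Data.Bool using (Bool; true; false; _∨_; if_then_else_)
open import Relation.Binary.PropositionalEquality using (_≡_)

data Game : Set where
  ⟨_,_∣_,_⟩ : (m : ℕ) → (Fin m → Game) → (n : ℕ) → (Fin n → Game) → Game

noOpts : Fin zero → Game
noOpts ()

𝟎 : Game
𝟎 = ⟨ zero , noOpts ∣ zero , noOpts ⟩

𝟏 : Game
𝟏 = ⟨ 1 , (λ _ → 𝟎) ∣ zero , noOpts ⟩

Hg : Game
Hg = ⟨ zero , noOpts ∣ 1 , (λ _ → 𝟏) ⟩

infixl 6 _⊕_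
_⊕_ : Game → Game → Game
⟨ m , gl ∣ n , gr ⟩ ⊕ ⟨ m' , kl ∣ n' , kr ⟩ =
  ⟨ m + m' , (λ k → [ (λ i → gl i ⊕ ⟨ m' , kl ∣ n' , kr ⟩)
                    , (λ j → ⟨ m , gl ∣ n , gr ⟩ ⊕ kl j) ] (splitAt m k))
  ∣ n + n' , (λ k → [ (λ i → gr i ⊕ ⟨ m' , kl ∣ n' , kr ⟩)
                    , (λ j → ⟨ m , gl ∣ n , gr ⟩ ⊕ kr j) ] (splitAt n k)) ⟩

conj : Game → Game
conj ⟨ m , gl ∣ n , gr ⟩ = ⟨ n , (λ j → conj (gr j)) ∣ m , (λ i → conj (gl i)) ⟩

data Player : Set where
  ℒ ℛ : Player

isℒ : Player → Bool
isℒ ℒ = true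
isℒ ℛ = false

isℛ : Player → Bool
isℛ ℒ = false
isℛ ℛ = true

anyFin : (m : ℕ) → (Fin m → Bool) → Bool
anyFin zero f = false
anyFin (suc m) f = f Fin.zero ∨ anyFin m (λ i → f (Fin.suc i))

-- Misère outcomes:
-- oL G = ℒ iff G has no Left option or some oR (G^L) = ℒ
-- oR G = ℛ iff G has no Right option or some oL (G^R) = ℛ
oL : Game → Player
oR : Game → Player
oL ⟨ zero , gl ∣ n , gr ⟩ = ℒ
oL ⟨ suc m , gl ∣ n , gr ⟩ =
  if anyFin (suc m) (λ i → isℒ (oR (gl i))) then ℒ else ℛ
oR ⟨ m , gl ∣ zero , gr ⟩ = ℛ
oR ⟨ m , gl ∣ suc n , gr ⟩ =
  if anyFin (suc n) (λ j → isℛ (oL (gr j))) then ℛ else ℒ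

outcome : Game → Player × Player
outcome G = oL G , oR G

data 𝒟 (A : Game → Set) : Game → Set where
  base  : ∀ {G} → A G → 𝒟 A G
  optL  : ∀ {m gl n gr} → 𝒟 A ⟨ m , gl ∣ n , gr ⟩ → (i : Fin m) → 𝒟 A (gl i)
  optR  : ∀ {m gl n gr} → 𝒟 A ⟨ m , gl ∣ n , gr ⟩ → (j : Fin n) → 𝒟 A (gr j)
  sum   : ∀ {G K} → 𝒟 A G → 𝒟 A K → 𝒟 A (G ⊕ K)
  conjC : ∀ {G} → 𝒟 A G → 𝒟 A (conj G)
  form  : ∀ {m n} (gl : Fin (suc m) → Game) (gr : Fin (suc n) → Game) →
          (∀ i → 𝒟 A (gl i)) → (∀ j → 𝒟 A (gr j)) →
          𝒟 A ⟨ suc m , gl ∣ suc n , gr ⟩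

_≡[_]_ : Game → (Game → Set) → Game → Set
G ≡[ U ] K = ∀ X → U X → outcome (G ⊕ X) ≡ outcome (K ⊕ X)

module Submission where

open import Defs
open import Relation.Binary.PropositionalEquality using (_≡_; refl; subst; sym; cong; cong₂; trans; module ≡-Reasoning)
open import Relation.Binary.Definitions using (_Respects_)
open import Data.Nat using (zero; suc)
open import Data.Fin using (Fin; splitAt; _↑ˡ_)
open import Data.Fin.Properties using (splitAt-↑ˡ)
open import Data.Sum using (inj₁; inj₂; [_,_])
open import Data.Product using (_×_; _,_; proj₁; proj₂)
open import Data.Bool using (Bool; true; false; _∨_; if_then_else_)
open import Data.Bool.Properties using (∨-zeroʳ)

-- Left, moving first in H + X, must play in X, so only Right's extra move H → 1
-- can change an outcome.  When X has a Right option this move never helps Right: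
-- if Right loses moving first in X, Left answers 1 → 0 in 1 + X and hands him X.
-- When X is a Right end, Right is forced into 1 + X and wins there, because every
-- Right end in D(H) is strong: after each Left move Right either has no move (a
-- misère win) or moves to another strong Right end.  Strong Right ends are closed
-- under sums, so this holds hereditarily for the followers of H, their
-- conjugates, and everything generated from them.

anyFin-cong : ∀ n {f g : Fin n → Bool} → (∀ i → f i ≡ g i) → anyFin n f ≡ anyFin n g
anyFin-cong zero    f≡g = refl
anyFin-cong (suc n) f≡g = cong₂ _∨_ (f≡g Fin.zero) (anyFin-cong n (λ i → f≡g (Fin.suc i)))

anyFin-true : ∀ n (f : Fin n → Bool) (i : Fin n) → f i ≡ true → anyFin n f ≡ true
anyFin-true (suc n) f Fin.zero    fi≡true rewrite fi≡true = refl
anyFin-true (suc n) f (Fin.suc i) fi≡true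
  rewrite anyFin-true n (λ j → f (Fin.suc j)) i fi≡true = ∨-zeroʳ (f Fin.zero)

anyFin-false : ∀ n (f : Fin n → Bool) → (∀ i → f i ≡ false) → anyFin n f ≡ false
anyFin-false zero    f f≡false = refl
anyFin-false (suc n) f f≡false
  rewrite f≡false Fin.zero = anyFin-false n (λ i → f (Fin.suc i)) (λ i → f≡false (Fin.suc i))

∨-redundantˡ : ∀ a b → (b ≡ false → a ≡ false) → a ∨ b ≡ b
∨-redundantˡ a true  _       = ∨-zeroʳ a
∨-redundantˡ a false b⇒a≡false rewrite b⇒a≡false refl = refl

[,]-pointwise : ∀ {A B : Set} (R : Game → Game → Set) {f f′ : A → Game} {g g′ : B → Game} →
                (∀ a → R (f a) (f′ a)) → (∀ b → R (g b) (g′ b)) →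
                ∀ s → R ([ f , g ] s) ([ f′ , g′ ] s)
[,]-pointwise R Rf Rg (inj₁ a) = Rf a
[,]-pointwise R Rf Rg (inj₂ b) = Rg b

[,]-all : ∀ {A B : Set} (P : Game → Set) {f : A → Game} {g : B → Game} →
          (∀ a → P (f a)) → (∀ b → P (g b)) → ∀ s → P ([ f , g ] s)
[,]-all P Pf Pg (inj₁ a) = Pf a
[,]-all P Pf Pg (inj₂ b) = Pg b

oL-𝟎⊕ : ∀ X → oL (𝟎 ⊕ X) ≡ oL X
oR-𝟎⊕ : ∀ X → oR (𝟎 ⊕ X) ≡ oR X
oL-𝟎⊕ ⟨ zero  , gl ∣ n , gr ⟩ = refl
oL-𝟎⊕ ⟨ suc m , gl ∣ n , gr ⟩ =
  cong (if_then ℒ else ℛ) (anyFin-cong (suc m) (λ i → cong isℒ (oR-𝟎⊕ (gl i))))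
oR-𝟎⊕ ⟨ m , gl ∣ zero  , gr ⟩ = refl
oR-𝟎⊕ ⟨ m , gl ∣ suc n , gr ⟩ =
  cong (if_then ℛ else ℒ) (anyFin-cong (suc n) (λ j → cong isℛ (oL-𝟎⊕ (gr j))))

-- Structural identity of game forms: conj ∘ conj and the distribution of conj
-- over ⊕ hold only up to it, since options are functions.
infix 4 _≅_
data _≅_ : Game → Game → Set where
  ≅-node : ∀ {m gl gl′ n gr gr′} → (∀ i → gl i ≅ gl′ i) → (∀ j → gr j ≅ gr′ j) →
           ⟨ m , gl ∣ n , gr ⟩ ≅ ⟨ m , gl′ ∣ n , gr′ ⟩

≅-conj-conj : ∀ X → X ≅ conj (conj X)
≅-conj-conj ⟨ m , gl ∣ n , gr ⟩ = ≅-node (λ i → ≅-conj-conj (gl i)) (λ j → ≅-conj-conj (gr j))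

≅-conj-⊕ : ∀ A B → conj A ⊕ conj B ≅ conj (A ⊕ B)
≅-conj-⊕ A@(⟨ m , gl ∣ n , gr ⟩) B@(⟨ m′ , kl ∣ n′ , kr ⟩) =
  ≅-node (λ k → [,]-pointwise R (λ i → ≅-conj-⊕ (gr i) B) (λ j → ≅-conj-⊕ A (kr j)) (splitAt n k))
         (λ k → [,]-pointwise R (λ i → ≅-conj-⊕ (gl i) B) (λ j → ≅-conj-⊕ A (kl j)) (splitAt m k))
  where
  R : Game → Game → Set
  R X Y = X ≅ conj Y

data RightEnd : Game → Set where
  rightEnd : ∀ {m gl gr} → RightEnd ⟨ m , gl ∣ zero , gr ⟩

rightEnd-⊕⁻ : ∀ A B → RightEnd (A ⊕ B) → RightEnd A × RightEnd B
rightEnd-⊕⁻ ⟨ m , gl ∣ zero , gr ⟩ ⟨ m′ , kl ∣ zero , kr ⟩ rightEnd = rightEnd , rightEnd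

data StrongRightEnd : Game → Set
data RightCanAnswer : Game → Set

data StrongRightEnd where
  strong : ∀ {m gl gr} → (∀ i → RightCanAnswer (gl i)) → StrongRightEnd ⟨ m , gl ∣ zero , gr ⟩

data RightCanAnswer where
  atRightEnd : ∀ {m gl gr} → RightCanAnswer ⟨ m , gl ∣ zero , gr ⟩
  answer     : ∀ {m gl n gr} (j : Fin n) → StrongRightEnd (gr j) → RightCanAnswer ⟨ m , gl ∣ n , gr ⟩

strong-⊕     : ∀ {A B} → StrongRightEnd A → StrongRightEnd B → StrongRightEnd (A ⊕ B)
canAnswer-⊕ˡ : ∀ {Z B} → RightCanAnswer Z → StrongRightEnd B → RightCanAnswer (Z ⊕ B)
canAnswer-⊕ʳ : ∀ {A Z} → StrongRightEnd A → RightCanAnswer Z → RightCanAnswer (A ⊕ Z)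
strong-⊕ {⟨ m , gl ∣ zero , gr ⟩} {⟨ m′ , kl ∣ zero , kr ⟩} sA@(strong ansA) sB@(strong ansB) =
  strong (λ k → [,]-all RightCanAnswer (λ i → canAnswer-⊕ˡ (ansA i) sB)
                                       (λ j → canAnswer-⊕ʳ sA (ansB j)) (splitAt m k))
canAnswer-⊕ˡ {⟨ m , gl ∣ zero , gr ⟩} {⟨ m′ , kl ∣ zero , kr ⟩} atRightEnd (strong _) = atRightEnd
canAnswer-⊕ˡ {Z@(⟨ m , gl ∣ n , gr ⟩)} {B@(⟨ m′ , kl ∣ zero , kr ⟩)} (answer j sj) sB =
  answer (j ↑ˡ 0)
    (subst (λ s → StrongRightEnd ([ (λ i → gr i ⊕ B) , (λ l → Z ⊕ kr l) ] s))
           (sym (splitAt-↑ˡ n j 0)) (strong-⊕ sj sB))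
canAnswer-⊕ʳ {⟨ m , gl ∣ zero , gr ⟩} {⟨ m′ , kl ∣ zero , kr ⟩} (strong _) atRightEnd = atRightEnd
canAnswer-⊕ʳ {⟨ m , gl ∣ zero , gr ⟩} sA@(strong _) (answer j sj) = answer j (strong-⊕ sA sj)

strong-resp    : StrongRightEnd Respects _≅_
canAnswer-resp : RightCanAnswer Respects _≅_
strong-resp (≅-node l≅ _) (strong ans) = strong (λ i → canAnswer-resp (l≅ i) (ans i))
canAnswer-resp (≅-node _ _) atRightEnd = atRightEnd
canAnswer-resp (≅-node _ r≅) (answer j sj) = answer j (strong-resp (r≅ j) sj)

data Hereditary (P : Game → Set) : Game → Set where
  hereditary : ∀ {m gl n gr} → P ⟨ m , gl ∣ n , gr ⟩ →
               (∀ i → Hereditary P (gl i)) → (∀ j → Hereditary P (gr j)) →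
               Hereditary P ⟨ m , gl ∣ n , gr ⟩

hereditary-⊕ : ∀ {P} → (∀ {A B} → P A → P B → P (A ⊕ B)) →
               ∀ {A B} → Hereditary P A → Hereditary P B → Hereditary P (A ⊕ B)
hereditary-⊕ {P} P-⊕ {⟨ m , gl ∣ n , gr ⟩} hA@(hereditary pA hlA hrA) hB@(hereditary pB hlB hrB) =
  hereditary (P-⊕ pA pB)
    (λ k → [,]-all (Hereditary P) (λ i → hereditary-⊕ P-⊕ (hlA i) hB)
                                  (λ j → hereditary-⊕ P-⊕ hA (hlB j)) (splitAt m k))
    (λ k → [,]-all (Hereditary P) (λ i → hereditary-⊕ P-⊕ (hrA i) hB)
                                  (λ j → hereditary-⊕ P-⊕ hA (hrB j)) (splitAt n k))

hereditary-resp : ∀ {P} → P Respects _≅_ → Hereditary P Respects _≅_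
hereditary-resp P-resp A≅B@(≅-node l≅ r≅) (hereditary p hl hr) =
  hereditary (P-resp A≅B p) (λ i → hereditary-resp P-resp (l≅ i) (hl i))
                            (λ j → hereditary-resp P-resp (r≅ j) (hr j))

StrongIfRightEnd : Game → Set
StrongIfRightEnd X = RightEnd X → StrongRightEnd X

strongIfRightEnd-⊕ : ∀ {A B} → StrongIfRightEnd A → StrongIfRightEnd B → StrongIfRightEnd (A ⊕ B)
strongIfRightEnd-⊕ {A} {B} sA sB end with rightEnd-⊕⁻ A B end
... | endA , endB = strong-⊕ (sA endA) (sB endB)

strongIfRightEnd-resp : StrongIfRightEnd Respects _≅_
strongIfRightEnd-resp A≅B@(≅-node _ _) s rightEnd = strong-resp A≅B (s rightEnd)

-- Left ends of X are the conjugates of the Right ends of conj X.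
EndsStrong : Game → Set
EndsStrong X = Hereditary StrongIfRightEnd X × Hereditary StrongIfRightEnd (conj X)

endsStrong-⊕ : ∀ {A B} → EndsStrong A → EndsStrong B → EndsStrong (A ⊕ B)
endsStrong-⊕ {A} {B} (hA , hA′) (hB , hB′) =
  hereditary-⊕ strongIfRightEnd-⊕ hA hB ,
  hereditary-resp strongIfRightEnd-resp (≅-conj-⊕ A B) (hereditary-⊕ strongIfRightEnd-⊕ hA′ hB′)

endsStrong-conj : ∀ {X} → EndsStrong X → EndsStrong (conj X)
endsStrong-conj {X} (h , h′) = h′ , hereditary-resp strongIfRightEnd-resp (≅-conj-conj X) h

endsStrong-H : EndsStrong Hg
endsStrong-H = hereditary (λ ()) (λ ()) (λ _ → hereditary-𝟏) ,
               hereditary (λ { rightEnd → strong (λ _ → answer Fin.zero (strong (λ ()))) })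
                          (λ _ → hereditary (λ ()) (λ ()) (λ _ → noOptions)) (λ ())
  where
  noOptions : ∀ {gl gr} → Hereditary StrongIfRightEnd ⟨ zero , gl ∣ zero , gr ⟩
  noOptions = hereditary (λ { rightEnd → strong (λ ()) }) (λ ()) (λ ())
  hereditary-𝟏 : Hereditary StrongIfRightEnd 𝟏
  hereditary-𝟏 = hereditary (λ { rightEnd → strong (λ _ → atRightEnd) }) (λ _ → noOptions) (λ ())

𝒟[H]⇒endsStrong : ∀ {X} → 𝒟 (_≡ Hg) X → EndsStrong X
𝒟[H]⇒endsStrong (base refl) = endsStrong-H
𝒟[H]⇒endsStrong (optL d i) with 𝒟[H]⇒endsStrong d
... | hereditary _ hl _ , hereditary _ _ hr′ = hl i , hr′ i
𝒟[H]⇒endsStrong (optR d j) with 𝒟[H]⇒endsStrong d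
... | hereditary _ _ hr , hereditary _ hl′ _ = hr j , hl′ j
𝒟[H]⇒endsStrong (sum d e) = endsStrong-⊕ (𝒟[H]⇒endsStrong d) (𝒟[H]⇒endsStrong e)
𝒟[H]⇒endsStrong (conjC d) = endsStrong-conj (𝒟[H]⇒endsStrong d)
𝒟[H]⇒endsStrong (form gl gr dl dr) =
  hereditary (λ ()) (λ i → proj₁ (𝒟[H]⇒endsStrong (dl i))) (λ j → proj₁ (𝒟[H]⇒endsStrong (dr j))) ,
  hereditary (λ ()) (λ j → proj₂ (𝒟[H]⇒endsStrong (dr j))) (λ i → proj₂ (𝒟[H]⇒endsStrong (dl i)))

oL-𝟏⊕-strong    : ∀ {Y} → StrongRightEnd Y → oL (𝟏 ⊕ Y) ≡ ℛ
oR-𝟏⊕-canAnswer : ∀ {Z} → RightCanAnswer Z → oR (𝟏 ⊕ Z) ≡ ℛ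
oL-𝟏⊕-strong {⟨ m , gl ∣ zero , gr ⟩} (strong ans)
  rewrite anyFin-false m (λ i → isℒ (oR (𝟏 ⊕ gl i))) (λ i → cong isℒ (oR-𝟏⊕-canAnswer (ans i))) = refl
oR-𝟏⊕-canAnswer atRightEnd = refl
oR-𝟏⊕-canAnswer {⟨ m , gl ∣ suc n , gr ⟩} (answer j sj)
  rewrite anyFin-true (suc n) (λ j → isℛ (oL (𝟏 ⊕ gr j))) j (cong isℛ (oL-𝟏⊕-strong sj)) = refl

oL-𝟏⊕ : ∀ X → oR X ≡ ℒ → oL (𝟏 ⊕ X) ≡ ℒ
oL-𝟏⊕ X@(⟨ m , gl ∣ n , gr ⟩) oR≡ℒ rewrite oR-𝟎⊕ X | oR≡ℒ = refl

oL-H⊕ : ∀ {X} → Hereditary StrongIfRightEnd X → oL (Hg ⊕ X) ≡ oL X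
oR-H⊕ : ∀ {X} → Hereditary StrongIfRightEnd X → oR (Hg ⊕ X) ≡ oR X
oL-H⊕ {⟨ zero  , gl ∣ n , gr ⟩} _ = refl
oL-H⊕ {⟨ suc m , gl ∣ n , gr ⟩} (hereditary _ hl _) =
  cong (if_then ℒ else ℛ) (anyFin-cong (suc m) (λ i → cong isℒ (oR-H⊕ (hl i))))
oR-H⊕ {⟨ m , gl ∣ zero , gr ⟩} (hereditary s _ _) rewrite oL-𝟏⊕-strong (s rightEnd) = refl
oR-H⊕ {X@(⟨ m , gl ∣ suc n , gr ⟩)} (hereditary _ _ hr) =
  cong (if_then ℛ else ℒ) (begin
    isℛ (oL (𝟏 ⊕ X)) ∨ anyFin (suc n) (λ j → isℛ (oL (Hg ⊕ gr j)))
      ≡⟨ cong (isℛ (oL (𝟏 ⊕ X)) ∨_) (anyFin-cong (suc n) (λ j → cong isℛ (oL-H⊕ (hr j)))) ⟩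
    isℛ (oL (𝟏 ⊕ X)) ∨ anyFin (suc n) (λ j → isℛ (oL (gr j)))
      ≡⟨ ∨-redundantˡ _ _ (λ noWin → cong isℛ (oL-𝟏⊕ X (cong (if_then ℛ else ℒ) noWin))) ⟩
    anyFin (suc n) (λ j → isℛ (oL (gr j)))
      ∎)
  where open ≡-Reasoning

proposition7p3 : Hg ≡[ 𝒟 (_≡ Hg) ] 𝟎
proposition7p3 X X∈U = cong₂ _,_ (trans (oL-H⊕ h) (sym (oL-𝟎⊕ X))) (trans (oR-H⊕ h) (sym (oR-𝟎⊕ X)))
  where
  h : Hereditary StrongIfRightEnd X
  h = proj₁ (𝒟[H]⇒endsStrong X∈U)
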